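{- Let $\alpha=v/w$ be a rational number in $(0,1]$ in lowest terms. For an integer $q\ge1$ define \[ \delta_\alpha(q)=\#\{p\in\mathbb{Z} : (1-\alpha)q<p\le q,\ \gcd(p,q)=1\},\qquad \kappa_\alpha(q)=\sum_{r=1}^{w-1}(1-\{\alpha r\})\sum_{\substack{d\mid q\\ d\equiv r \bmod w}}\mu\!\left(\frac{q}{d}\right). \] Then $\delta_\alpha(q)=\alpha\varphi(q)+\kappa_\alpha(q)$ for every integer $q\ge1$.
   Context: $\{x\}$ denotes the fractional part of $x$, $\mu$ the Möbius function, $\varphi$ Euler's totient function; the inner sum runs over positive divisors $d$ of $q$. -}

module Defs where

open import Data.Nat as ℕ using (ℕ; zero; suc; NonZero; _%_)
open import Data.Nat.DivMod using (_/_)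
open import Data.Nat.Divisibility using (_∣?_)
open import Data.Nat.GCD using (gcd)
open import Data.Nat.Primality using (prime?)
open import Data.Integer as ℤ using (ℤ; +_)
open import Data.Rational as ℚ using (ℚ; 0ℚ; 1ℚ; floor)
open import Data.Rational.Properties using (_<?_)
open import Data.List using (List; map; filter; length; foldr)
open import Data.Bool.ListAction using (any)
open import Data.List.Base using (upTo)
open import Data.Bool using (Bool; if_then_else_; _∧_)
open import Relation.Nullary using (does)
open import Relation.Nullary.Decidable using (_×-dec_)

range1 : ℕ → List ℕ
range1 n = map suc (upTo n)

ℕ→ℚ : ℕ → ℚ
ℕ→ℚ n = ℚ._/_ (+ n) 1

ℤ→ℚ : ℤ → ℚ
ℤ→ℚ z = ℚ._/_ z 1

sumℤ : List ℤ → ℤ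
sumℤ = foldr ℤ._+_ (+ 0)

sumℚ : List ℚ → ℚ
sumℚ = foldr ℚ._+_ 0ℚ

frac : ℚ → ℚ
frac x = x ℚ.- ℤ→ℚ (floor x)

negOnePow : ℕ → ℤ
negOnePow zero    = + 1
negOnePow (suc k) = ℤ.- negOnePow k

hasSquareFactor : ℕ → Bool
hasSquareFactor n = any (λ p → does (prime? p ×-dec (p ℕ.* p ∣? n))) (range1 n)

ω : ℕ → ℕ
ω n = length (filter (λ p → prime? p ×-dec (p ∣? n)) (range1 n))

μ : ℕ → ℤ
μ n = if hasSquareFactor n then + 0 else negOnePow (ω n)

φ : ℕ → ℕ
φ q = length (filter (λ p → gcd p q ℕ.≟ 1) (range1 q))

α : (v w : ℕ) → .{{_ : NonZero w}} → ℚ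
α v w = ℚ._/_ (+ v) w

-- δ_α(q) = #{p ∈ ℤ : (1-α)q < p ≤ q, gcd(p,q) = 1}.
-- Since (1-α)q ≥ 0 for α ≤ 1, such p are ≥ 1, so we enumerate p ∈ [1..q].
δ : (v w : ℕ) → .{{_ : NonZero w}} → ℕ → ℕ
δ v w q = length (filter
  (λ p → ((1ℚ ℚ.- α v w) ℚ.* ℕ→ℚ q <? ℕ→ℚ p) ×-dec (gcd p q ℕ.≟ 1))
  (range1 q))

divSum : (w : ℕ) → .{{_ : NonZero w}} → ℕ → ℕ → ℤ
divSum w q r = sumℤ (map term (upTo q))
  where
  term : ℕ → ℤ
  term k = if does (suc k ∣? q) ∧ does (suc k % w ℕ.≟ r % w)
           then μ (q / suc k) else + 0

κ : (v w : ℕ) → .{{_ : NonZero w}} → ℕ → ℚ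
κ v w q = sumℚ (map
  (λ r → (1ℚ ℚ.- frac (α v w ℚ.* ℕ→ℚ r)) ℚ.* ℤ→ℚ (divSum w q r))
  (range1 (w ℕ.∸ 1)))

module Submission where

-- Möbius inversion of the coprimality condition gives
--   δ_α(q) = Σ_{d ∣ q} μ(d) N(q/d),  N(D) = #{1 ≤ j ≤ D : (w − v) D < w j} = D − ⌊(w − v) D / w⌋,
-- so w N(D) = v D + ((w − v) D mod w), and the terms v D add up to v φ(q).  In the sum of the
-- residues substitute d ↦ q/d and split by the class r of d mod w: the residue depends only on
-- d mod w and vanishes when w ∣ d, and for 0 < r < w coprimality of v and w gives
-- (w − v) r mod w = w (1 − {α r}).  Hence w δ_α(q) = v φ(q) + w κ_α(q), an identity in ℤ.

open import Data.Nat as ℕ using (ℕ; zero; suc; _≤_; _<_; z≤n; s≤s; _∸_; _%_; NonZero)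
import Data.Nat.Properties as ℕ
open import Data.Nat.Divisibility
open import Data.Nat.DivMod
open import Data.Nat.GCD using (gcd; gcd[m,n]∣m; gcd[m,n]∣n; gcd-greatest; gcd[m,n]≢0)
open import Data.Nat.Coprimality using (Coprime; coprime-divisor)
import Data.Nat.Coprimality as Coprime
open import Data.Nat.Primality
  using (Prime; prime?; euclidsLemma; prime⇒irreducible; prime⇒nonZero; ¬prime[1])
open import Data.Nat.Primality.Factorisation using (factorise)
open import Data.Nat.ListAction using (product)
open import Data.Integer as ℤ using (ℤ; +_)
import Data.Integer.Properties as ℤ
open import Data.List using ([]; _∷_; map; filter; length; applyUpTo; upTo)
open import Data.List.Properties using (map-applyUpTo)
open import Data.List.Relation.Unary.All using (_∷_)
open import Data.List.Relation.Unary.Any using (satisfied)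
open import Data.List.Relation.Unary.Any.Properties using (any⁺; any⁻)
open import Data.List.Membership.Propositional using (_∈_; lose)
open import Data.List.Membership.Propositional.Properties using (∈-map⁺; ∈-upTo⁺)
open import Data.Bool using (Bool; true; false; if_then_else_; T; _∧_)
open import Data.Product using (∃-syntax; _×_; _,_; proj₂)
open import Data.Empty using (⊥-elim)
open import Data.Sum using (_⊎_; inj₁; inj₂; [_,_])
open import Function using (_∘_; id; _⇔_; mk⇔; Equivalence)
open import Level using (Level)
open import Relation.Nullary using (Dec; yes; no; does; ¬_)
open import Relation.Nullary.Decidable using (_×-dec_; ¬?; dec-true; dec-false)
open import Relation.Unary using (Pred; Decidable)
open import Relation.Binary.PropositionalEquality
  using (_≡_; _≢_; refl; sym; trans; cong; cong₂; subst; subst₂; module ≡-Reasoning)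

open import Defs

module IntegerSums where

  open import Data.Integer using (0ℤ; 1ℤ; _+_; _*_; -_)
  open import Algebra.Properties.CommutativeSemigroup ℤ.+-commutativeSemigroup
    using () renaming (interchange to +-interchange)
  open import Algebra.Properties.CommutativeSemigroup ℤ.*-commutativeSemigroup
    using () renaming (x∙yz≈y∙xz to ℤ-x*yz≡y*xz)
  open import Algebra.Properties.CommutativeSemigroup ℕ.+-commutativeSemigroup
    using () renaming (interchange to ℕ-+-interchange)
  open import Algebra.Properties.CommutativeSemigroup ℕ.*-commutativeSemigroup
    using () renaming (x∙yz≈y∙xz to ℕ-x*yz≡y*xz)
  open ≡-Reasoning

  ∑ : ℕ → (ℕ → ℤ) → ℤ
  ∑ zero    f = 0ℤ
  ∑ (suc n) f = f 0 + ∑ n (f ∘ suc)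

  infixl 10 ∑
  syntax ∑ n (λ k → e) = ∑[ k < n ] e

  ∑-cong : ∀ n {f g : ℕ → ℤ} → (∀ k → k < n → f k ≡ g k) → ∑ n f ≡ ∑ n g
  ∑-cong zero    eq = refl
  ∑-cong (suc n) eq = cong₂ _+_ (eq 0 ℕ.z<s) (∑-cong n (λ k → eq (suc k) ∘ s≤s))

  ∑-zero : ∀ n {f : ℕ → ℤ} → (∀ k → k < n → f k ≡ 0ℤ) → ∑ n f ≡ 0ℤ
  ∑-zero zero    eq = refl
  ∑-zero (suc n) eq = cong₂ _+_ (eq 0 ℕ.z<s) (∑-zero n (λ k → eq (suc k) ∘ s≤s))

  ∑-const-1 : ∀ n → ∑[ _ < n ] (+ 1) ≡ + n
  ∑-const-1 zero    = refl
  ∑-const-1 (suc n) = cong (_+_ 1ℤ) (∑-const-1 n)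

  ∑-distrib-+ : ∀ n (f g : ℕ → ℤ) → ∑[ k < n ] (f k + g k) ≡ ∑ n f + ∑ n g
  ∑-distrib-+ zero    f g = refl
  ∑-distrib-+ (suc n) f g = trans
    (cong (_+_ (f 0 + g 0)) (∑-distrib-+ n (f ∘ suc) (g ∘ suc)))
    (+-interchange (f 0) (g 0) (∑ n (f ∘ suc)) (∑ n (g ∘ suc)))

  *-distribˡ-∑ : ∀ n c (f : ℕ → ℤ) → c * ∑ n f ≡ ∑[ k < n ] (c * f k)
  *-distribˡ-∑ zero    c f = ℤ.*-zeroʳ c
  *-distribˡ-∑ (suc n) c f =
    trans (ℤ.*-distribˡ-+ c (f 0) _) (cong (_+_ (c * f 0)) (*-distribˡ-∑ n c (f ∘ suc)))

  neg-distrib-∑ : ∀ n (f : ℕ → ℤ) → - ∑ n f ≡ ∑[ k < n ] (- f k)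
  neg-distrib-∑ zero    f = refl
  neg-distrib-∑ (suc n) f =
    trans (ℤ.neg-distrib-+ (f 0) _) (cong (_+_ (- f 0)) (neg-distrib-∑ n (f ∘ suc)))

  ∑-comm : ∀ m n (f : ℕ → ℕ → ℤ) → ∑[ i < m ] ∑[ j < n ] f i j ≡ ∑[ j < n ] ∑[ i < m ] f i j
  ∑-comm zero    n f = sym (∑-zero n (λ _ _ → refl))
  ∑-comm (suc m) n f = begin
    ∑ n (f 0) + ∑[ i < m ] ∑[ j < n ] f (suc i) j
      ≡⟨ cong (_+_ (∑ n (f 0))) (∑-comm m n (f ∘ suc)) ⟩
    ∑ n (f 0) + ∑[ j < n ] ∑[ i < m ] f (suc i) j
      ≡⟨ ∑-distrib-+ n (f 0) _ ⟨
    ∑[ j < n ] (f 0 j + ∑[ i < m ] f (suc i) j) ∎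

  ∑-split : ∀ m n (f : ℕ → ℤ) → ∑ (m ℕ.+ n) f ≡ ∑ m f + ∑[ k < n ] f (m ℕ.+ k)
  ∑-split zero    n f = sym (ℤ.+-identityˡ _)
  ∑-split (suc m) n f = trans (cong (_+_ (f 0)) (∑-split m n (f ∘ suc))) (sym (ℤ.+-assoc (f 0) _ _))

  ∑-truncate : ∀ m n (f : ℕ → ℤ) → m ≤ n → (∀ k → m ≤ k → k < n → f k ≡ 0ℤ) → ∑ n f ≡ ∑ m f
  ∑-truncate m n f m≤n vanish = begin
    ∑ n f
      ≡⟨ cong (λ n → ∑ n f) (ℕ.m+[n∸m]≡n m≤n) ⟨
    ∑ (m ℕ.+ (n ∸ m)) f
      ≡⟨ ∑-split m (n ∸ m) f ⟩
    ∑ m f + ∑[ k < n ∸ m ] f (m ℕ.+ k)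
      ≡⟨ cong (_+_ (∑ m f)) (∑-zero (n ∸ m) tail-vanishes) ⟩
    ∑ m f + 0ℤ
      ≡⟨ ℤ.+-identityʳ _ ⟩
    ∑ m f ∎
    where
    tail-vanishes : ∀ k → k < n ∸ m → f (m ℕ.+ k) ≡ 0ℤ
    tail-vanishes k k<n∸m = vanish (m ℕ.+ k) (ℕ.m≤m+n m k)
      (subst (m ℕ.+ k <_) (ℕ.m+[n∸m]≡n m≤n) (ℕ.+-monoʳ-< m k<n∸m))

  ∑-single : ∀ n (f : ℕ → ℤ) i → i < n → (∀ k → k < n → k ≢ i → f k ≡ 0ℤ) → ∑ n f ≡ f i
  ∑-single (suc n) f zero    _ vanish = trans
    (cong (_+_ (f 0)) (∑-zero n (λ k k<n → vanish (suc k) (s≤s k<n) (λ ()))))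
    (ℤ.+-identityʳ _)
  ∑-single (suc n) f (suc i) (s≤s i<n) vanish = trans
    (cong (_+ ∑ n (f ∘ suc)) (vanish 0 ℕ.z<s (λ ())))
    (trans (ℤ.+-identityˡ _)
      (∑-single n (f ∘ suc) i i<n (λ k k<n k≢i → vanish (suc k) (s≤s k<n) (k≢i ∘ ℕ.suc-injective))))

  private variable
    ℓ ℓ′ : Level
    A : Set ℓ
    B : Set ℓ′

  T-does⇔ : (a? : Dec A) → T (does a?) ⇔ A
  T-does⇔ (yes a)  = mk⇔ (λ _ → a) _
  T-does⇔ (no ¬a) = mk⇔ (λ ()) ¬a

  when : Dec A → ℤ → ℤ
  when a? x = if does a? then x else 0ℤ

  when-yes : (a? : Dec A) {x : ℤ} → A → when a? x ≡ x
  when-yes a? a = cong (if_then _ else _) (dec-true a? a)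

  when-no : (a? : Dec A) {x : ℤ} → ¬ A → when a? x ≡ 0ℤ
  when-no a? ¬a = cong (if_then _ else _) (dec-false a? ¬a)

  when-cong : (a? : Dec A) {x y : ℤ} → (A → x ≡ y) → when a? x ≡ when a? y
  when-cong (yes a) eq = eq a
  when-cong (no _)  eq = refl

  when-⇔ : (a? : Dec A) (b? : Dec B) {x : ℤ} → (A → B) → (B → A) → when a? x ≡ when b? x
  when-⇔ (yes a)  b? f g = sym (when-yes b? (f a))
  when-⇔ (no ¬a) b? f g = sym (when-no b? (¬a ∘ g))

  when-0 : (a? : Dec A) → when a? 0ℤ ≡ 0ℤ
  when-0 (yes _) = refl
  when-0 (no _)  = refl

  when-distrib-+ : (a? : Dec A) (x y : ℤ) → when a? (x + y) ≡ when a? x + when a? y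
  when-distrib-+ (yes _) x y = refl
  when-distrib-+ (no _)  x y = refl

  *-when : (a? : Dec A) (c x : ℤ) → c * when a? x ≡ when a? (c * x)
  *-when (yes _) c x = refl
  *-when (no _)  c x = ℤ.*-zeroʳ c

  neg-when : (a? : Dec A) (x : ℤ) → - when a? x ≡ when a? (- x)
  neg-when (yes _) x = refl
  neg-when (no _)  x = refl

  when-∑ : (a? : Dec A) (n : ℕ) (f : ℕ → ℤ) → when a? (∑ n f) ≡ ∑[ k < n ] when a? (f k)
  when-∑ (yes _) n f = refl
  when-∑ (no _)  n f = sym (∑-zero n (λ _ _ → refl))

  indicator-* : (a? : Dec A) (x : ℤ) → when a? x ≡ when a? (+ 1) * x
  indicator-* (yes _) x = sym (ℤ.*-identityˡ x)
  indicator-* (no _)  x = refl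

  when-*-comm : (a? : Dec A) (x y : ℤ) → when a? x * y ≡ x * when a? y
  when-*-comm (yes _) x y = refl
  when-*-comm (no _)  x y = sym (ℤ.*-zeroʳ x)

  when-split : (a? : Dec A) (x : ℤ) → x ≡ when a? x + when (¬? a?) x
  when-split (yes _) x = sym (ℤ.+-identityʳ x)
  when-split (no _)  x = sym (ℤ.+-identityˡ x)

  when-× : (a? : Dec A) (b? : Dec B) (x : ℤ) → when (a? ×-dec b?) x ≡ when a? (when b? x)
  when-× (yes _) (yes _) x = refl
  when-× (yes _) (no _)  x = refl
  when-× (no _)  b?      x = refl

  if-∧≡when-when : ∀ (a? : Dec A) (b? : Dec B) x →
    (if does a? ∧ does b? then x else 0ℤ) ≡ when a? (when b? x)
  if-∧≡when-when (yes _) (yes _) x = refl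
  if-∧≡when-when (yes _) (no _)  x = refl
  if-∧≡when-when (no _)  b?      x = refl

  when-comm : (a? : Dec A) (b? : Dec B) (x : ℤ) → when a? (when b? x) ≡ when b? (when a? x)
  when-comm (yes _) b? x = refl
  when-comm (no _)  b? x = sym (when-0 b?)

  ∑-indicator-threshold : ∀ {p} {P : Pred ℕ p} (P? : Decidable P) n s →
    (∀ j → s ≤ j → P j) → (∀ j → P j → s ≤ j) →
    ∑[ j < n ] when (P? j) (+ 1) ≡ + (n ∸ s)
  ∑-indicator-threshold P? zero    s       above below = cong +_ (sym (ℕ.0∸n≡0 s))
  ∑-indicator-threshold P? (suc n) zero    above below = cong₂ _+_
    (when-yes (P? 0) (above 0 z≤n))
    (∑-indicator-threshold (P? ∘ suc) n 0 (λ j _ → above (suc j) z≤n) (λ _ _ → z≤n))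
  ∑-indicator-threshold P? (suc n) (suc s) above below = trans (cong₂ _+_
    (when-no (P? 0) (λ P0 → ℕ.n≮0 (below 0 P0)))
    (∑-indicator-threshold (P? ∘ suc) n s (λ j → above (suc j) ∘ s≤s) (λ j → ℕ.s≤s⁻¹ ∘ below (suc j))))
    (ℤ.+-identityˡ _)

  sumℤ-applyUpTo : ∀ n (f : ℕ → ℤ) → sumℤ (applyUpTo f n) ≡ ∑ n f
  sumℤ-applyUpTo zero    f = refl
  sumℤ-applyUpTo (suc n) f = cong (_+_ (f 0)) (sumℤ-applyUpTo n (f ∘ suc))

  sumℤ-map-upTo : ∀ n (f : ℕ → ℤ) → sumℤ (map f (upTo n)) ≡ ∑ n f
  sumℤ-map-upTo n f = trans (cong sumℤ (map-applyUpTo id f n)) (sumℤ-applyUpTo n f)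

  sumℤ-map-range1 : ∀ n (f : ℕ → ℤ) → sumℤ (map f (range1 n)) ≡ ∑[ k < n ] f (suc k)
  sumℤ-map-range1 n f = begin
    sumℤ (map f (map suc (applyUpTo id n)))   ≡⟨ cong (sumℤ ∘ map f) (map-applyUpTo id suc n) ⟩
    sumℤ (map f (applyUpTo suc n))            ≡⟨ cong sumℤ (map-applyUpTo suc f n) ⟩
    sumℤ (applyUpTo (f ∘ suc) n)              ≡⟨ sumℤ-applyUpTo n (f ∘ suc) ⟩
    ∑[ k < n ] f (suc k)                      ∎

  length-filter : ∀ {p} {P : Pred ℕ p} (P? : Decidable P) xs →
    + length (filter P? xs) ≡ sumℤ (map (λ x → when (P? x) (+ 1)) xs)
  length-filter P? []       = refl
  length-filter P? (x ∷ xs) with does (P? x)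
  ... | false = trans (length-filter P? xs) (sym (ℤ.+-identityˡ _))
  ... | true  = cong (_+_ 1ℤ) (length-filter P? xs)

  length-filter-range1 : ∀ {p} {P : Pred ℕ p} (P? : Decidable P) n →
    + length (filter P? (range1 n)) ≡ ∑[ k < n ] when (P? (suc k)) (+ 1)
  length-filter-range1 P? n = trans (length-filter P? (range1 n)) (sumℤ-map-range1 n _)

  -- Sums over divisors

  -- The summand receives NonZero d, so it may divide by d.
  ∑∣ : ℕ → ((d : ℕ) → .{{NonZero d}} → ℤ) → ℤ
  ∑∣ n f = ∑[ k < n ] when (suc k ∣? n) (f (suc k))

  infixl 10 ∑∣
  syntax ∑∣ n (λ d → e) = ∑[ d ∣ n ] e

  ∑∣-cong : ∀ n {f g : (d : ℕ) → .{{NonZero d}} → ℤ} →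
    (∀ d .{{_ : NonZero d}} → d ∣ n → f d ≡ g d) → ∑[ d ∣ n ] f d ≡ ∑[ d ∣ n ] g d
  ∑∣-cong n eq = ∑-cong n (λ k _ → when-cong (suc k ∣? n) (eq (suc k)))

  ∑∣-distrib-+ : ∀ n (f g : (d : ℕ) → .{{NonZero d}} → ℤ) →
    ∑[ d ∣ n ] (f d + g d) ≡ ∑[ d ∣ n ] f d + ∑[ d ∣ n ] g d
  ∑∣-distrib-+ n f g = trans
    (∑-cong n (λ k _ → when-distrib-+ (suc k ∣? n) (f (suc k)) (g (suc k))))
    (∑-distrib-+ n _ _)

  *-distribˡ-∑∣ : ∀ n c (f : (d : ℕ) → .{{NonZero d}} → ℤ) → c * ∑[ d ∣ n ] f d ≡ ∑[ d ∣ n ] (c * f d)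
  *-distribˡ-∑∣ n c f =
    trans (*-distribˡ-∑ n c _) (∑-cong n (λ k _ → *-when (suc k ∣? n) c (f (suc k))))

  *-distribʳ-∑∣ : ∀ n c (f : (d : ℕ) → .{{NonZero d}} → ℤ) → ∑[ d ∣ n ] f d * c ≡ ∑[ d ∣ n ] (f d * c)
  *-distribʳ-∑∣ n c f = trans (ℤ.*-comm (∑[ d ∣ n ] f d) c)
    (trans (*-distribˡ-∑∣ n c f) (∑∣-cong n (λ d _ → ℤ.*-comm c (f d))))

  ∑∣-∑-comm : ∀ n m (f : (d : ℕ) → .{{NonZero d}} → ℕ → ℤ) →
    ∑[ d ∣ n ] ∑[ i < m ] f d i ≡ ∑[ i < m ] ∑[ d ∣ n ] f d i
  ∑∣-∑-comm n m f = trans (∑-cong n (λ k _ → when-∑ (suc k ∣? n) m (f (suc k)))) (∑-comm n m _)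

  ∑∣-extend : ∀ n N (f : ℕ → ℤ) → 1 ≤ n → n ≤ N →
    ∑[ k < N ] when (suc k ∣? n) (f (suc k)) ≡ ∑[ d ∣ n ] f d
  ∑∣-extend n N f 1≤n n≤N = ∑-truncate n N _ n≤N (λ k n≤k _ → when-no (suc k ∣? n)
    (>⇒∤ ⦃ ℕ.>-nonZero 1≤n ⦄ (s≤s n≤k)))

  ∑-multiples : ∀ m d .{{_ : NonZero d}} (h : ℕ → ℤ) →
    ∑[ k < m ℕ.* d ] when (d ∣? suc k) (h (suc k)) ≡ ∑[ j < m ] h (d ℕ.* suc j)
  ∑-multiples zero    d       h = refl
  ∑-multiples (suc m) (suc d) h = begin
    ∑ (suc d ℕ.+ m ℕ.* suc d) F                     ≡⟨ ∑-split (suc d) (m ℕ.* suc d) F ⟩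
    ∑ (suc d) F + ∑[ k < m ℕ.* suc d ] F (suc d ℕ.+ k)
      ≡⟨ cong₂ _+_ first-block (∑-cong (m ℕ.* suc d) (λ k _ → shift k)) ⟩
    h (suc d ℕ.* 1) + ∑[ k < m ℕ.* suc d ] when (suc d ∣? suc k) (h (suc d ℕ.+ suc k))
      ≡⟨ cong (_+_ (h (suc d ℕ.* 1))) (∑-multiples m (suc d) (h ∘ (suc d ℕ.+_))) ⟩
    h (suc d ℕ.* 1) + ∑[ j < m ] h (suc d ℕ.+ suc d ℕ.* suc j)
      ≡⟨ cong (_+_ (h (suc d ℕ.* 1))) (∑-cong m (λ j _ → cong h (sym (ℕ.*-suc (suc d) (suc j))))) ⟩
    h (suc d ℕ.* 1) + ∑[ j < m ] h (suc d ℕ.* suc (suc j)) ∎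
    where
    F : ℕ → ℤ
    F k = when (suc d ∣? suc k) (h (suc k))
    first-block : ∑ (suc d) F ≡ h (suc d ℕ.* 1)
    first-block = begin
      ∑ (suc d) F
        ≡⟨ ∑-single (suc d) F d ℕ.≤-refl (λ k k<d+1 k≢d → when-no (suc d ∣? suc k)
                           (λ d+1∣k+1 → k≢d (ℕ.≤-antisym (ℕ.s≤s⁻¹ k<d+1) (ℕ.s≤s⁻¹ (∣⇒≤ d+1∣k+1))))) ⟩
      F d
        ≡⟨ when-yes (suc d ∣? suc d) ∣-refl ⟩
      h (suc d)
        ≡⟨ cong h (ℕ.*-identityʳ (suc d)) ⟨
      h (suc d ℕ.* 1) ∎
    shift : ∀ k → F (suc d ℕ.+ k) ≡ when (suc d ∣? suc k) (h (suc d ℕ.+ suc k))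
    shift k = begin
      when (suc d ∣? suc (suc d ℕ.+ k)) (h (suc (suc d ℕ.+ k)))
        ≡⟨ cong (λ x → when (suc d ∣? x) (h x)) (ℕ.+-suc (suc d) k) ⟨
      when (suc d ∣? (suc d ℕ.+ suc k)) (h (suc d ℕ.+ suc k))
        ≡⟨ when-⇔ (suc d ∣? (suc d ℕ.+ suc k)) (suc d ∣? suc k)
             (λ p → ∣m+n∣m⇒∣n p ∣-refl) (∣m∣n⇒∣m+n ∣-refl) ⟩
      when (suc d ∣? suc k) (h (suc d ℕ.+ suc k)) ∎

  ∑-cofactor : ∀ d n (X : ℕ → ℤ) → 1 ≤ n →
    ∑[ b < n ] when (suc d ℕ.* suc b ℕ.≟ n) (X (suc b)) ≡ when (suc d ∣? n) (X (n / suc d))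
  ∑-cofactor d n X 1≤n = by-cases (suc d ∣? n)
    where
    single : ∀ D → suc d ℕ.* D ≡ n → ∑[ b < n ] when (suc d ℕ.* suc b ℕ.≟ n) (X (suc b)) ≡ X D
    by-cases : Dec (suc d ∣ n) →
      ∑[ b < n ] when (suc d ℕ.* suc b ℕ.≟ n) (X (suc b)) ≡ when (suc d ∣? n) (X (n / suc d))
    by-cases (no d+1∤n) = trans
      (∑-zero n (λ b _ → when-no (suc d ℕ.* suc b ℕ.≟ n)
        (λ eq → d+1∤n (divides (suc b) (trans (sym eq) (ℕ.*-comm (suc d) (suc b)))))))
      (sym (when-no (suc d ∣? n) d+1∤n))
    by-cases (yes d+1∣n) =
      trans (single (n / suc d) (m*[n/m]≡n d+1∣n)) (sym (when-yes (suc d ∣? n) d+1∣n))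
    single zero    eq = ⊥-elim (ℕ.n≮0 (subst (1 ≤_) (trans (sym eq) (ℕ.*-zeroʳ (suc d))) 1≤n))
    single (suc D) eq = trans
      (∑-single n _ D (subst (D <_) eq (ℕ.m≤n*m (suc D) (suc d)))
        (λ b _ b≢D → when-no (suc d ℕ.* suc b ℕ.≟ n)
          (λ eq′ → b≢D (ℕ.suc-injective (ℕ.*-cancelˡ-≡ (suc b) (suc D) (suc d) (trans eq′ (sym eq)))))))
      (when-yes (suc d ℕ.* suc D ℕ.≟ n) eq)

  -- Both sides are the sum over the pairs (d, e) with d e = n.
  ∑∣-cofactor-swap : ∀ n (F : ℕ → ℕ → ℤ) → ∑[ d ∣ n ] F d (n / d) ≡ ∑[ d ∣ n ] F (n / d) d
  ∑∣-cofactor-swap zero    F = refl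
  ∑∣-cofactor-swap n@(suc _) F = begin
    ∑[ k < n ] when (suc k ∣? n) (F (suc k) (n / suc k))
      ≡⟨ ∑-cong n (λ k _ → ∑-cofactor k n (F (suc k)) ℕ.z<s) ⟨
    ∑[ k < n ] ∑[ b < n ] when (suc k ℕ.* suc b ℕ.≟ n) (F (suc k) (suc b))
      ≡⟨ ∑-comm n n (λ k b → when (suc k ℕ.* suc b ℕ.≟ n) (F (suc k) (suc b))) ⟩
    ∑[ b < n ] ∑[ k < n ] when (suc k ℕ.* suc b ℕ.≟ n) (F (suc k) (suc b))
      ≡⟨ ∑-cong n (λ b _ → ∑-cong n (λ k _ →
           when-⇔ (suc k ℕ.* suc b ℕ.≟ n) (suc b ℕ.* suc k ℕ.≟ n) {F (suc k) (suc b)}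
           (trans (ℕ.*-comm (suc b) (suc k))) (trans (ℕ.*-comm (suc k) (suc b))))) ⟩
    ∑[ b < n ] ∑[ k < n ] when (suc b ℕ.* suc k ℕ.≟ n) (F (suc k) (suc b))
      ≡⟨ ∑-cong n (λ b _ → ∑-cofactor b n (λ e → F e (suc b)) ℕ.z<s) ⟩
    ∑[ b < n ] when (suc b ∣? n) (F (n / suc b) (suc b)) ∎

  -- The Möbius function

  prime∣prime⇒≡ : ∀ {p r} → Prime p → Prime r → p ∣ r → p ≡ r
  prime∣prime⇒≡ pp pr p∣r with prime⇒irreducible pr p∣r
  ... | inj₁ refl = ⊥-elim (¬prime[1] pp)
  ... | inj₂ p≡r  = p≡r

  prime∤⇒coprime : ∀ {p x} → Prime p → ¬ p ∣ x → Coprime x p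
  prime∤⇒coprime pp p∤x (d∣x , d∣p) with prime⇒irreducible pp d∣p
  ... | inj₁ d≡1 = d≡1
  ... | inj₂ refl = ⊥-elim (p∤x d∣x)

  ∃-prime-factor : ∀ n → 2 ≤ n → ∃[ p ] ∃[ m ] (Prime p × 1 ≤ m × n ≡ p ℕ.* m)
  ∃-prime-factor n 2≤n with factorise n ⦃ ℕ.>-nonZero (ℕ.<-trans ℕ.z<s 2≤n) ⦄
  ... | record { factors = [] ; isFactorisation = n≡1 } = ⊥-elim (ℕ.<-irrefl (sym n≡1) 2≤n)
  ... | record { factors = p ∷ ps ; isFactorisation = n≡p*m ; factorsPrime = pp ∷ _ } =
    p , product ps , pp , ℕ.n≢0⇒n>0 m≢0 , n≡p*m
    where
    m≢0 : product ps ≢ 0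
    m≢0 m≡0 = ℕ.<-irrefl (sym (trans n≡p*m (trans (cong (p ℕ.*_) m≡0) (ℕ.*-zeroʳ p))))
                         (ℕ.<-trans ℕ.z<s 2≤n)

  hasSquareFactor⇔ : ∀ n → 1 ≤ n → T (hasSquareFactor n) ⇔ (∃[ p ] Prime p × p ℕ.* p ∣ n)
  hasSquareFactor⇔ n 1≤n = mk⇔
    (λ t → let p , p-passes = satisfied (any⁻ test (range1 n) t)
           in p , Equivalence.to (T-does⇔ (square-test p)) p-passes)
    (λ (p , pp , p²∣n) → any⁺ test
      (lose (p∈range1 pp p²∣n) (Equivalence.from (T-does⇔ (square-test p)) (pp , p²∣n))))
    where
    square-test : ∀ p → Dec (Prime p × p ℕ.* p ∣ n)
    square-test p = prime? p ×-dec (p ℕ.* p ∣? n)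
    test : ℕ → Bool
    test p = does (square-test p)
    p∈range1 : ∀ {p} → Prime p → p ℕ.* p ∣ n → p ∈ range1 n
    p∈range1 {suc p} _ p²∣n = ∈-map⁺ suc (∈-upTo⁺ (ℕ.<-≤-trans (ℕ.n<1+n p)
      (ℕ.≤-trans (ℕ.m≤m*n (suc p) (suc p)) (∣⇒≤ ⦃ ℕ.>-nonZero 1≤n ⦄ p²∣n))))

  T-injective : ∀ {x y} → (T x ⇔ T y) → x ≡ y
  T-injective {false} {false} _   = refl
  T-injective {false} {true}  x⇔y = ⊥-elim (Equivalence.from x⇔y _)
  T-injective {true}  {false} x⇔y = ⊥-elim (Equivalence.to x⇔y _)
  T-injective {true}  {true}  _   = refl

  indicator-⊎ : ∀ {c} {C : Set c} (a? : Dec A) (b? : Dec B) (c? : Dec C) →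
    (A → B ⊎ C) → (B → A) → (C → A) → (B → ¬ C) →
    when a? (+ 1) ≡ when b? (+ 1) + when c? (+ 1)
  indicator-⊎ (yes a) (yes b) c?      to fromB fromC disj = sym (trans
    (cong (_+_ 1ℤ) (when-no c? (disj b))) (ℤ.+-identityʳ _))
  indicator-⊎ (yes a) (no ¬b) (yes c) to fromB fromC disj = refl
  indicator-⊎ (yes a) (no ¬b) (no ¬c) to fromB fromC disj = ⊥-elim ([ ¬b , ¬c ] (to a))
  indicator-⊎ (no ¬a) (yes b) c?      to fromB fromC disj = ⊥-elim (¬a (fromB b))
  indicator-⊎ (no ¬a) (no ¬b) (yes c) to fromB fromC disj = ⊥-elim (¬a (fromC c))
  indicator-⊎ (no ¬a) (no ¬b) (no ¬c) to fromB fromC disj = refl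

  primeDivisor? : ∀ n k → Dec (Prime k × k ∣ n)
  primeDivisor? n k = prime? k ×-dec (k ∣? n)

  ω-∑ : ∀ n N → 1 ≤ n → n ≤ N → + ω n ≡ ∑[ k < N ] when (primeDivisor? n (suc k)) (+ 1)
  ω-∑ n N 1≤n n≤N = trans (length-filter-range1 (primeDivisor? n) n) (sym (∑-truncate n N _ n≤N
    (λ k n≤k _ → when-no (primeDivisor? n (suc k))
      (>⇒∤ ⦃ ℕ.>-nonZero 1≤n ⦄ (s≤s n≤k) ∘ proj₂))))

  module _ {p e : ℕ} (pp : Prime p) (p∤e : ¬ p ∣ e) (1≤e : 1 ≤ e) where

    private
      e≤p*e : e ≤ p ℕ.* e
      e≤p*e = ℕ.m≤n*m e p ⦃ prime⇒nonZero pp ⦄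

      1≤p*e : 1 ≤ p ℕ.* e
      1≤p*e = ℕ.≤-trans 1≤e e≤p*e

    ω-*-prime : ω (p ℕ.* e) ≡ suc (ω e)
    ω-*-prime = ℤ.+-injective (begin
      + ω (p ℕ.* e)
        ≡⟨ ω-∑ (p ℕ.* e) (p ℕ.* e) 1≤p*e ℕ.≤-refl ⟩
      ∑[ k < p ℕ.* e ] when (primeDivisor? (p ℕ.* e) (suc k)) (+ 1)
        ≡⟨ ∑-cong (p ℕ.* e) (λ k _ → indicator-⊎ (primeDivisor? (p ℕ.* e) (suc k))
             (primeDivisor? e (suc k)) (suc k ℕ.≟ p) split (λ (r , r∣e) → r , ∣n⇒∣m*n p r∣e)
             (λ { refl → pp , ∣m⇒∣m*n e ∣-refl }) (λ { (_ , r∣e) refl → p∤e r∣e })) ⟩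
      ∑[ k < p ℕ.* e ] (when (primeDivisor? e (suc k)) (+ 1) + when (suc k ℕ.≟ p) (+ 1))
        ≡⟨ ∑-distrib-+ (p ℕ.* e) _ _ ⟩
      ∑[ k < p ℕ.* e ] when (primeDivisor? e (suc k)) (+ 1) + ∑[ k < p ℕ.* e ] when (suc k ℕ.≟ p) (+ 1)
        ≡⟨ cong₂ _+_ (sym (ω-∑ e (p ℕ.* e) 1≤e e≤p*e)) only-p ⟩
      + ω e + 1ℤ
        ≡⟨ ℤ.+-comm (+ ω e) 1ℤ ⟩
      + suc (ω e) ∎)
      where
      split : ∀ {r} → Prime r × r ∣ p ℕ.* e → (Prime r × r ∣ e) ⊎ r ≡ p
      split (pr , r∣pe) with euclidsLemma p e pr r∣pe
      ... | inj₁ r∣p = inj₂ (prime∣prime⇒≡ pr pp r∣p)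
      ... | inj₂ r∣e = inj₁ (pr , r∣e)
      only-p : ∑[ k < p ℕ.* e ] when (suc k ℕ.≟ p) (+ 1) ≡ + 1
      only-p = trans
        (∑-single (p ℕ.* e) _ (ℕ.pred p)
          (subst (_≤ p ℕ.* e) (sym p-1+1) (ℕ.m≤m*n p e ⦃ ℕ.>-nonZero 1≤e ⦄))
          (λ k _ k≢p-1 → when-no (suc k ℕ.≟ p) (k≢p-1 ∘ cong ℕ.pred)))
        (when-yes (suc (ℕ.pred p) ℕ.≟ p) p-1+1)
        where
        p-1+1 : suc (ℕ.pred p) ≡ p
        p-1+1 = ℕ.suc-pred p ⦃ prime⇒nonZero pp ⦄

    hasSquareFactor-*-prime : hasSquareFactor (p ℕ.* e) ≡ hasSquareFactor e
    hasSquareFactor-*-prime = T-injective (mk⇔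
      (λ t → let r , pr , r²∣pe = Equivalence.to (hasSquareFactor⇔ (p ℕ.* e) 1≤p*e) t
             in Equivalence.from (hasSquareFactor⇔ e 1≤e) (r , pr , cancel-p pr r²∣pe))
      (λ t → let r , pr , r²∣e = Equivalence.to (hasSquareFactor⇔ e 1≤e) t
             in Equivalence.from (hasSquareFactor⇔ (p ℕ.* e) 1≤p*e) (r , pr , ∣n⇒∣m*n p r²∣e)))
      where
      cancel-p : ∀ {r} → Prime r → r ℕ.* r ∣ p ℕ.* e → r ℕ.* r ∣ e
      cancel-p {r} pr r²∣pe with r ℕ.≟ p
      ... | yes refl = ⊥-elim (p∤e (*-cancelˡ-∣ p ⦃ prime⇒nonZero pp ⦄ r²∣pe))
      ... | no  r≢p  = coprime-divisor (prime∤⇒coprime pp p∤r²) r²∣pe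
        where
        p∤r² : ¬ p ∣ r ℕ.* r
        p∤r² p∣r² = r≢p (sym (prime∣prime⇒≡ pp pr ([ id , id ] (euclidsLemma r r pp p∣r²))))

    μ-*-prime : μ (p ℕ.* e) ≡ - μ e
    μ-*-prime = flip-sign hasSquareFactor-*-prime ω-*-prime
      where
      flip-sign : ∀ {s s′ k k′} → s ≡ s′ → k ≡ suc k′ →
        (if s then + 0 else negOnePow k) ≡ - (if s′ then + 0 else negOnePow k′)
      flip-sign {true}  refl refl = refl
      flip-sign {false} refl refl = refl

  μ-*-prime-∣ : ∀ {p e} → Prime p → p ∣ e → 1 ≤ e → μ (p ℕ.* e) ≡ 0ℤ
  μ-*-prime-∣ {p} {e} pp p∣e 1≤e = if-true (Equivalence.from (hasSquareFactor⇔ (p ℕ.* e) 1≤p*e)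
    (p , pp , *-monoʳ-∣ p p∣e))
    where
    1≤p*e : 1 ≤ p ℕ.* e
    1≤p*e = ℕ.≤-trans 1≤e (ℕ.m≤n*m e p ⦃ prime⇒nonZero pp ⦄)
    if-true : ∀ {b} {x y : ℤ} → T b → (if b then x else y) ≡ x
    if-true {true} _ = refl

  -- Split the divisors of p m by whether p divides them: d = p d′ contributes −μ(d′) exactly
  -- when p ∤ d′, which cancels the divisors prime to p.
  ∑∣-μ-prime-multiple : ∀ p m → Prime p → 1 ≤ m → ∑[ d ∣ p ℕ.* m ] μ d ≡ 0ℤ
  ∑∣-μ-prime-multiple (suc p′) m pp 1≤m = begin
    ∑[ d ∣ N ] μ d
      ≡⟨ ∑-cong N (λ k _ → when-split (p ∣? suc k) (W k)) ⟩
    ∑[ k < N ] (when (p ∣? suc k) (W k) + when (¬? (p ∣? suc k)) (W k))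
      ≡⟨ ∑-distrib-+ N _ _ ⟩
    ∑[ k < N ] when (p ∣? suc k) (W k) + ∑[ k < N ] when (¬? (p ∣? suc k)) (W k)
      ≡⟨ cong₂ _+_ multiples-of-p coprime-to-p ⟩
    - S + S
      ≡⟨ ℤ.+-inverseˡ S ⟩
    0ℤ ∎
    where
    p = suc p′
    N = p ℕ.* m
    W : ℕ → ℤ
    W k = when (suc k ∣? N) (μ (suc k))
    S = ∑[ j < m ] when (¬? (p ∣? suc j)) (when (suc j ∣? m) (μ (suc j)))

    p∤⇒∣N⇒∣m : ∀ {d} → ¬ p ∣ d → d ∣ N → d ∣ m
    p∤⇒∣N⇒∣m p∤d = coprime-divisor (prime∤⇒coprime pp p∤d)

    multiple-term : ∀ j → when (p ℕ.* suc j ∣? N) (μ (p ℕ.* suc j))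
                        ≡ - when (¬? (p ∣? suc j)) (when (suc j ∣? m) (μ (suc j)))
    multiple-term j = by-cases (p ∣? suc j)
      where
      by-cases : Dec (p ∣ suc j) → when (p ℕ.* suc j ∣? N) (μ (p ℕ.* suc j))
                                  ≡ - when (¬? (p ∣? suc j)) (when (suc j ∣? m) (μ (suc j)))
      by-cases (yes p∣j+1) = begin
        when (p ℕ.* suc j ∣? N) (μ (p ℕ.* suc j))
          ≡⟨ when-cong (p ℕ.* suc j ∣? N) (λ _ → μ-*-prime-∣ pp p∣j+1 ℕ.z<s) ⟩
        when (p ℕ.* suc j ∣? N) 0ℤ
          ≡⟨ when-0 (p ℕ.* suc j ∣? N) ⟩
        - 0ℤ
          ≡⟨ cong -_ (when-no (¬? (p ∣? suc j)) (λ p∤j+1 → p∤j+1 p∣j+1)) ⟨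
        - when (¬? (p ∣? suc j)) (when (suc j ∣? m) (μ (suc j))) ∎
      by-cases (no p∤j+1) = begin
        when (p ℕ.* suc j ∣? N) (μ (p ℕ.* suc j))
          ≡⟨ when-⇔ (p ℕ.* suc j ∣? N) (suc j ∣? m) (*-cancelˡ-∣ p) (*-monoʳ-∣ p) ⟩
        when (suc j ∣? m) (μ (p ℕ.* suc j))
          ≡⟨ cong (when (suc j ∣? m)) (μ-*-prime pp p∤j+1 ℕ.z<s) ⟩
        when (suc j ∣? m) (- μ (suc j))
          ≡⟨ neg-when (suc j ∣? m) (μ (suc j)) ⟨
        - when (suc j ∣? m) (μ (suc j))
          ≡⟨ cong -_ (when-yes (¬? (p ∣? suc j)) p∤j+1) ⟨
        - when (¬? (p ∣? suc j)) (when (suc j ∣? m) (μ (suc j))) ∎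

    multiples-of-p : ∑[ k < N ] when (p ∣? suc k) (W k) ≡ - S
    multiples-of-p = begin
      ∑[ k < N ] when (p ∣? suc k) (W k)
        ≡⟨ cong (λ n → ∑[ k < n ] when (p ∣? suc k) (W k)) (ℕ.*-comm p m) ⟩
      ∑[ k < m ℕ.* p ] when (p ∣? suc k) (W k)
        ≡⟨ ∑-multiples m p (λ d → when (d ∣? N) (μ d)) ⟩
      ∑[ j < m ] when (p ℕ.* suc j ∣? N) (μ (p ℕ.* suc j))
        ≡⟨ ∑-cong m (λ j _ → multiple-term j) ⟩
      ∑[ j < m ] (- when (¬? (p ∣? suc j)) (when (suc j ∣? m) (μ (suc j))))
        ≡⟨ neg-distrib-∑ m _ ⟨
      - S ∎

    coprime-to-p : ∑[ k < N ] when (¬? (p ∣? suc k)) (W k) ≡ S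
    coprime-to-p = begin
      ∑[ k < N ] when (¬? (p ∣? suc k)) (W k)
        ≡⟨ ∑-cong N (λ k _ → when-cong (¬? (p ∣? suc k)) (λ p∤k+1 →
             when-⇔ (suc k ∣? N) (suc k ∣? m) (p∤⇒∣N⇒∣m p∤k+1) (∣n⇒∣m*n p))) ⟩
      ∑[ k < N ] when (¬? (p ∣? suc k)) (when (suc k ∣? m) (μ (suc k)))
        ≡⟨ ∑-truncate m N _ (ℕ.m≤n*m m p) (λ k m≤k _ → trans
             (cong (when (¬? (p ∣? suc k))) (when-no (suc k ∣? m)
               (>⇒∤ ⦃ ℕ.>-nonZero 1≤m ⦄ (s≤s m≤k))))
             (when-0 (¬? (p ∣? suc k)))) ⟩
      S ∎

  ∑∣-μ : ∀ n → 2 ≤ n → ∑[ d ∣ n ] μ d ≡ 0ℤ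
  ∑∣-μ n 2≤n with ∃-prime-factor n 2≤n
  ... | p , m , pp , 1≤m , refl = ∑∣-μ-prime-multiple p m pp 1≤m

  [n≡1]≡∑∣-μ : ∀ n → 1 ≤ n → when (n ℕ.≟ 1) (+ 1) ≡ ∑[ d ∣ n ] μ d
  [n≡1]≡∑∣-μ 1           _ = refl
  [n≡1]≡∑∣-μ (suc (suc n)) _ = sym (∑∣-μ (suc (suc n)) (s≤s (s≤s z≤n)))

  coprime-indicator : ∀ m n → 1 ≤ m → 1 ≤ n →
    when (gcd m n ℕ.≟ 1) (+ 1) ≡ ∑[ d ∣ n ] when (d ∣? m) (μ d)
  coprime-indicator m n 1≤m 1≤n = begin
    when (g ℕ.≟ 1) (+ 1)                     ≡⟨ [n≡1]≡∑∣-μ g 1≤g ⟩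
    ∑[ d ∣ g ] μ d                           ≡⟨ ∑∣-extend g n μ 1≤g g≤n ⟨
    ∑[ k < n ] when (suc k ∣? g) (μ (suc k))  ≡⟨ ∑-cong n (λ k _ → common-divisor (suc k)) ⟩
    ∑[ d ∣ n ] when (d ∣? m) (μ d)           ∎
    where
    g = gcd m n
    1≤g : 1 ≤ g
    1≤g = ℕ.n≢0⇒n>0 (gcd[m,n]≢0 m n (inj₁ (ℕ.n>0⇒n≢0 1≤m)))
    g≤n : g ≤ n
    g≤n = ∣⇒≤ ⦃ ℕ.>-nonZero 1≤n ⦄ (gcd[m,n]∣n m n)
    common-divisor : ∀ d → when (d ∣? g) (μ d) ≡ when (d ∣? n) (when (d ∣? m) (μ d))
    common-divisor d = trans
      (when-⇔ (d ∣? g) (d ∣? n ×-dec d ∣? m)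
        (λ d∣g → ∣-trans d∣g (gcd[m,n]∣n m n) , ∣-trans d∣g (gcd[m,n]∣m m n))
        (λ (d∣n , d∣m) → gcd-greatest d∣m d∣n))
      (when-× (d ∣? n) (d ∣? m) (μ d))

  ∑-coprime-Möbius : ∀ q (g : ℕ → ℤ) → 1 ≤ q →
    ∑[ k < q ] when (gcd (suc k) q ℕ.≟ 1) (g (suc k)) ≡
    ∑[ d ∣ q ] (μ d * ∑[ j < q / d ] g (d ℕ.* suc j))
  ∑-coprime-Möbius q g 1≤q = begin
    ∑[ k < q ] when (gcd (suc k) q ℕ.≟ 1) (g (suc k))
      ≡⟨ ∑-cong q (λ k _ → indicator-* (gcd (suc k) q ℕ.≟ 1) (g (suc k))) ⟩
    ∑[ k < q ] (when (gcd (suc k) q ℕ.≟ 1) (+ 1) * g (suc k))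
      ≡⟨ ∑-cong q (λ k _ → cong (_* g (suc k)) (coprime-indicator (suc k) q ℕ.z<s 1≤q)) ⟩
    ∑[ k < q ] (∑[ d ∣ q ] when (d ∣? suc k) (μ d) * g (suc k))
      ≡⟨ ∑-cong q (λ k _ → *-distribʳ-∑∣ q (g (suc k)) (λ d → when (d ∣? suc k) (μ d))) ⟩
    ∑[ k < q ] ∑[ d ∣ q ] (when (d ∣? suc k) (μ d) * g (suc k))
      ≡⟨ ∑∣-∑-comm q q (λ d k → when (d ∣? suc k) (μ d) * g (suc k)) ⟨
    ∑[ d ∣ q ] ∑[ k < q ] (when (d ∣? suc k) (μ d) * g (suc k))
      ≡⟨ ∑∣-cong q (λ d d∣q → trans (∑-cong q (λ k _ → when-*-comm (d ∣? suc k) (μ d) (g (suc k))))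
                                     (sym (*-distribˡ-∑ q (μ d) _))) ⟩
    ∑[ d ∣ q ] (μ d * ∑[ k < q ] when (d ∣? suc k) (g (suc k)))
      ≡⟨ ∑∣-cong q (λ d d∣q → cong (μ d *_) (multiples d d∣q)) ⟩
    ∑[ d ∣ q ] (μ d * ∑[ j < q / d ] g (d ℕ.* suc j)) ∎
    where
    multiples : ∀ d .{{_ : NonZero d}} → d ∣ q →
      ∑[ k < q ] when (d ∣? suc k) (g (suc k)) ≡ ∑[ j < q / d ] g (d ℕ.* suc j)
    multiples d d∣q = trans
      (cong (λ n → ∑[ k < n ] when (d ∣? suc k) (g (suc k))) (sym (m/n*n≡m d∣q)))
      (∑-multiples (q / d) d g)

  φ≡∑∣ : ∀ q → 1 ≤ q → + φ q ≡ ∑[ d ∣ q ] (μ d * + (q / d))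
  φ≡∑∣ q 1≤q = begin
    + φ q
      ≡⟨ length-filter-range1 (λ p → gcd p q ℕ.≟ 1) q ⟩
    ∑[ k < q ] when (gcd (suc k) q ℕ.≟ 1) (+ 1)
      ≡⟨ ∑-coprime-Möbius q (λ _ → + 1) 1≤q ⟩
    ∑[ d ∣ q ] (μ d * ∑[ _ < q / d ] (+ 1))
      ≡⟨ ∑∣-cong q (λ d _ → cong (μ d *_) (∑-const-1 (q / d))) ⟩
    ∑[ d ∣ q ] (μ d * + (q / d)) ∎

  -- Counting points above the threshold

  ∑-count-above : ∀ t w .{{_ : NonZero w}} D →
    ∑[ j < D ] when (t ℕ.<? w ℕ.* suc j) (+ 1) ≡ + (D ∸ t / w)
  ∑-count-above t w D = ∑-indicator-threshold (λ j → t ℕ.<? w ℕ.* suc j) D (t / w) above below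
    where
    above : ∀ j → t / w ≤ j → t < w ℕ.* suc j
    above j t/w≤j = subst (_< w ℕ.* suc j) (sym (m≡m%n+[m/n]*n t w)) (ℕ.<-≤-trans
      (ℕ.+-monoˡ-< (t / w ℕ.* w) (m%n<n t w))
      (subst (w ℕ.+ t / w ℕ.* w ≤_) (ℕ.*-comm (suc j) w) (ℕ.+-monoʳ-≤ w (ℕ.*-monoˡ-≤ w t/w≤j))))
    below : ∀ j → t < w ℕ.* suc j → t / w ≤ j
    below j t<w[j+1] = ℕ.s≤s⁻¹ (m<n*o⇒m/o<n (subst (t <_) (ℕ.*-comm w (suc j)) t<w[j+1]))

  *-count-above : ∀ v w .{{_ : NonZero w}} D → v ≤ w →
    + w * ∑[ j < D ] when ((w ∸ v) ℕ.* D ℕ.<? w ℕ.* suc j) (+ 1) ≡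
    + (v ℕ.* D) + + ((w ∸ v) ℕ.* D % w)
  *-count-above v w D v≤w = begin
    + w * ∑[ j < D ] when (t ℕ.<? w ℕ.* suc j) (+ 1)
      ≡⟨ cong (+ w *_) (∑-count-above t w D) ⟩
    + w * + (D ∸ s)
      ≡⟨ ℤ.pos-* w (D ∸ s) ⟨
    + (w ℕ.* (D ∸ s))
      ≡⟨ cong +_ (ℕ.+-cancelʳ-≡ (s ℕ.* w) _ _ (trans lhs (sym rhs))) ⟩
    + (v ℕ.* D ℕ.+ t % w)
      ≡⟨ ℤ.pos-+ (v ℕ.* D) (t % w) ⟩
    + (v ℕ.* D) + + (t % w) ∎
    where
    t = (w ∸ v) ℕ.* D
    s = t / w
    s≤D : s ≤ D
    s≤D = subst (s ≤_) (trans (cong (_/ w) (ℕ.*-comm w D)) (m*n/n≡m D w))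
            (/-monoˡ-≤ w (ℕ.*-monoˡ-≤ D (ℕ.m∸n≤m w v)))
    lhs : w ℕ.* (D ∸ s) ℕ.+ s ℕ.* w ≡ w ℕ.* D
    lhs = begin
      w ℕ.* (D ∸ s) ℕ.+ s ℕ.* w          ≡⟨ cong₂ ℕ._+_ (ℕ.*-distribˡ-∸ w D s) (ℕ.*-comm s w) ⟩
      (w ℕ.* D ∸ w ℕ.* s) ℕ.+ w ℕ.* s    ≡⟨ ℕ.m∸n+n≡m (ℕ.*-monoʳ-≤ w s≤D) ⟩
      w ℕ.* D                            ∎
    rhs : v ℕ.* D ℕ.+ t % w ℕ.+ s ℕ.* w ≡ w ℕ.* D
    rhs = begin
      v ℕ.* D ℕ.+ t % w ℕ.+ s ℕ.* w      ≡⟨ ℕ.+-assoc (v ℕ.* D) (t % w) (s ℕ.* w) ⟩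
      v ℕ.* D ℕ.+ (t % w ℕ.+ s ℕ.* w)    ≡⟨ cong (v ℕ.* D ℕ.+_) (m≡m%n+[m/n]*n t w) ⟨
      v ℕ.* D ℕ.+ (w ∸ v) ℕ.* D          ≡⟨ ℕ.*-distribʳ-+ D v (w ∸ v) ⟨
      (v ℕ.+ (w ∸ v)) ℕ.* D              ≡⟨ cong (ℕ._* D) (ℕ.m+[n∸m]≡n v≤w) ⟩
      w ℕ.* D                            ∎

  expand-by-residue : ∀ w′ (f : ℕ → ℤ) → (∀ D → f D ≡ f (D % suc w′)) → f 0 ≡ 0ℤ →
    ∀ D → f D ≡ ∑[ r < w′ ] when (D % suc w′ ℕ.≟ suc r % suc w′) (f (suc r))
  expand-by-residue w′ f periodic f0≡0 D = by-residue (D % w) refl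
    where
    w = suc w′
    small : ∀ {r} → r < w′ → suc r % w ≡ suc r
    small r<w′ = m<n⇒m%n≡m (s≤s r<w′)
    by-residue : ∀ ρ → D % w ≡ ρ → f D ≡ ∑[ r < w′ ] when (D % w ℕ.≟ suc r % w) (f (suc r))
    by-residue zero D%w≡0 = begin
      f D                 ≡⟨ periodic D ⟩
      f (D % w)           ≡⟨ cong f D%w≡0 ⟩
      f 0                 ≡⟨ f0≡0 ⟩
      0ℤ                  ≡⟨ ∑-zero w′ (λ r r<w′ → when-no (D % w ℕ.≟ suc r % w) (other-class r<w′)) ⟨
      ∑[ r < w′ ] when (D % w ℕ.≟ suc r % w) (f (suc r)) ∎
      where
      other-class : ∀ {r} → r < w′ → D % w ≢ suc r % w
      other-class r<w′ eq = ℕ.0≢1+n (trans (sym D%w≡0) (trans eq (small r<w′)))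
    by-residue (suc r₀) D%w≡r₀+1 = begin
      f D                 ≡⟨ periodic D ⟩
      f (D % w)           ≡⟨ cong f D%w≡r₀+1 ⟩
      f (suc r₀)          ≡⟨ when-yes (D % w ℕ.≟ suc r₀ % w) (trans D%w≡r₀+1 (sym (small r₀<w′))) ⟨
      when (D % w ℕ.≟ suc r₀ % w) (f (suc r₀))
        ≡⟨ ∑-single w′ _ r₀ r₀<w′ (λ r r<w′ r≢r₀ →
             when-no (D % w ℕ.≟ suc r % w) (other-class r<w′ r≢r₀)) ⟨
      ∑[ r < w′ ] when (D % w ℕ.≟ suc r % w) (f (suc r)) ∎
      where
      r₀<w′ : r₀ < w′
      r₀<w′ = ℕ.s≤s⁻¹ (subst (_< w) D%w≡r₀+1 (m%n<n D w))
      other-class : ∀ {r} → r < w′ → r ≢ r₀ → D % w ≢ suc r % w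
      other-class r<w′ r≢r₀ eq =
        r≢r₀ (ℕ.suc-injective (trans (sym (small r<w′)) (trans (sym eq) D%w≡r₀+1)))

  [w∸v]*r%w : ∀ v w .{{_ : NonZero w}} r → v ≤ w → (v ℕ.* r) % w ≢ 0 →
    (w ∸ v) ℕ.* r % w ≡ w ∸ (v ℕ.* r) % w
  [w∸v]*r%w v w r v≤w b≢0 = begin
    (w ∸ v) ℕ.* r % w                 ≡⟨ cong (_% w) complement ⟨
    ((w ∸ b) ℕ.+ k ℕ.* w) % w         ≡⟨ [m+kn]%n≡m%n (w ∸ b) k w ⟩
    (w ∸ b) % w                       ≡⟨ m<n⇒m%n≡m (ℕ.∸-monoʳ-< (ℕ.n≢0⇒n>0 b≢0) b≤w) ⟩
    w ∸ b                             ∎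
    where
    b = (v ℕ.* r) % w
    a = (v ℕ.* r) / w
    k = r ∸ suc a
    b≤w : b ≤ w
    b≤w = ℕ.<⇒≤ (m%n<n (v ℕ.* r) w)
    vr≡b+aw : v ℕ.* r ≡ b ℕ.+ a ℕ.* w
    vr≡b+aw = m≡m%n+[m/n]*n (v ℕ.* r) w
    a<r : a < r
    a<r = ℕ.*-cancelʳ-< w a r (ℕ.<-≤-trans
      (subst (a ℕ.* w <_) (sym vr≡b+aw) (ℕ.m<n+m (a ℕ.* w) (ℕ.n≢0⇒n>0 b≢0)))
      (subst (v ℕ.* r ≤_) (ℕ.*-comm w r) (ℕ.*-monoˡ-≤ r v≤w)))
    complement : (w ∸ b) ℕ.+ k ℕ.* w ≡ (w ∸ v) ℕ.* r
    complement = ℕ.+-cancelʳ-≡ (v ℕ.* r) _ _ (begin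
      (w ∸ b) ℕ.+ k ℕ.* w ℕ.+ v ℕ.* r
        ≡⟨ cong ((w ∸ b) ℕ.+ k ℕ.* w ℕ.+_) vr≡b+aw ⟩
      (w ∸ b) ℕ.+ k ℕ.* w ℕ.+ (b ℕ.+ a ℕ.* w)
        ≡⟨ ℕ-+-interchange (w ∸ b) (k ℕ.* w) b (a ℕ.* w) ⟩
      (w ∸ b) ℕ.+ b ℕ.+ (k ℕ.* w ℕ.+ a ℕ.* w)
        ≡⟨ cong₂ ℕ._+_ (ℕ.m∸n+n≡m b≤w) (ℕ.+-comm (k ℕ.* w) (a ℕ.* w)) ⟩
      w ℕ.+ (a ℕ.* w ℕ.+ k ℕ.* w)
        ≡⟨ cong (w ℕ.+_) (ℕ.*-distribʳ-+ w a k) ⟨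
      suc (a ℕ.+ k) ℕ.* w
        ≡⟨ cong (ℕ._* w) (ℕ.m+[n∸m]≡n a<r) ⟩
      r ℕ.* w
        ≡⟨ ℕ.*-comm r w ⟩
      w ℕ.* r
        ≡⟨ cong (ℕ._* r) (ℕ.m∸n+n≡m v≤w) ⟨
      (w ∸ v ℕ.+ v) ℕ.* r
        ≡⟨ ℕ.*-distribʳ-+ r (w ∸ v) v ⟩
      (w ∸ v) ℕ.* r ℕ.+ v ℕ.* r ∎)

  divSum≡∑∣ : ∀ w .{{_ : NonZero w}} q r → divSum w q r ≡ ∑[ d ∣ q ] when (d % w ℕ.≟ r % w) (μ (q / d))
  divSum≡∑∣ w q r = trans (sumℤ-map-upTo q _)
    (∑-cong q (λ k _ → if-∧≡when-when (suc k ∣? q) (suc k % w ℕ.≟ r % w) (μ (q / suc k))))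

  module _ (v w′ : ℕ) where

    private
      w = suc w′

    -- w · count D = v D + residue D, and residue D = w (1 − {v D / w}) unless w ∣ v D.
    residue : ℕ → ℕ
    residue D = (w ∸ v) ℕ.* D % w

    count : ℕ → ℤ
    count D = ∑[ j < D ] when ((w ∸ v) ℕ.* D ℕ.<? w ℕ.* suc j) (+ 1)

    residue-periodic : ∀ D → + residue D ≡ + residue (D % w)
    residue-periodic D = cong +_ (begin
      (w ∸ v) ℕ.* D % w
        ≡⟨ %-distribˡ-* (w ∸ v) D w ⟩
      ((w ∸ v) % w ℕ.* (D % w)) % w
        ≡⟨ cong (λ x → ((w ∸ v) % w ℕ.* x) % w) (m%n%n≡m%n D w) ⟨
      ((w ∸ v) % w ℕ.* (D % w % w)) % w
        ≡⟨ %-distribˡ-* (w ∸ v) (D % w) w ⟨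
      (w ∸ v) ℕ.* (D % w) % w ∎)

    residue-0 : + residue 0 ≡ 0ℤ
    residue-0 = cong (λ x → + (x % w)) (ℕ.*-zeroʳ (w ∸ v))

    module _ (v≤w : v ≤ suc w′) (q : ℕ) (1≤q : 1 ≤ q) where

      count-coprime≡∑∣ : ∀ {c} {C : Pred ℕ c} (C? : Decidable C) →
        (∀ p → C p ⇔ (w ∸ v) ℕ.* q < w ℕ.* p) →
        ∑[ k < q ] when (C? (suc k) ×-dec (gcd (suc k) q ℕ.≟ 1)) (+ 1) ≡
        ∑[ d ∣ q ] (μ d * count (q / d))
      count-coprime≡∑∣ C? C⇔ = begin
        ∑[ k < q ] when (C? (suc k) ×-dec (gcd (suc k) q ℕ.≟ 1)) (+ 1)
          ≡⟨ ∑-cong q (λ k _ → trans (when-× (C? (suc k)) (gcd (suc k) q ℕ.≟ 1) (+ 1))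
                                     (when-comm (C? (suc k)) (gcd (suc k) q ℕ.≟ 1) (+ 1))) ⟩
        ∑[ k < q ] when (gcd (suc k) q ℕ.≟ 1) (when (C? (suc k)) (+ 1))
          ≡⟨ ∑-coprime-Möbius q (λ p → when (C? p) (+ 1)) 1≤q ⟩
        ∑[ d ∣ q ] (μ d * ∑[ j < q / d ] when (C? (d ℕ.* suc j)) (+ 1))
          ≡⟨ ∑∣-cong q (λ d d∣q → cong (μ d *_) (∑-cong (q / d) (λ j _ →
               when-⇔ (C? (d ℕ.* suc j)) ((w ∸ v) ℕ.* (q / d) ℕ.<? w ℕ.* suc j)
                 {+ 1} (scale d d∣q j ∘ Equivalence.to (C⇔ (d ℕ.* suc j)))
                 (Equivalence.from (C⇔ (d ℕ.* suc j)) ∘ unscale d d∣q j)))) ⟩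
        ∑[ d ∣ q ] (μ d * count (q / d)) ∎
        where
        factor : ∀ d .{{_ : NonZero d}} → d ∣ q → ∀ j →
          (w ∸ v) ℕ.* q ≡ d ℕ.* ((w ∸ v) ℕ.* (q / d)) × w ℕ.* (d ℕ.* suc j) ≡ d ℕ.* (w ℕ.* suc j)
        factor d d∣q j =
          trans (cong ((w ∸ v) ℕ.*_) (sym (m*[n/m]≡n d∣q))) (ℕ-x*yz≡y*xz (w ∸ v) d (q / d)) ,
          ℕ-x*yz≡y*xz w d (suc j)
        scale : ∀ d .{{_ : NonZero d}} → d ∣ q → ∀ j →
          (w ∸ v) ℕ.* q < w ℕ.* (d ℕ.* suc j) → (w ∸ v) ℕ.* (q / d) < w ℕ.* suc j
        scale d d∣q j lt = let eq₁ , eq₂ = factor d d∣q j in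
          ℕ.*-cancelˡ-< d _ _ (subst₂ _<_ eq₁ eq₂ lt)
        unscale : ∀ d .{{_ : NonZero d}} → d ∣ q → ∀ j →
          (w ∸ v) ℕ.* (q / d) < w ℕ.* suc j → (w ∸ v) ℕ.* q < w ℕ.* (d ℕ.* suc j)
        unscale d d∣q j lt = let eq₁ , eq₂ = factor d d∣q j in
          subst₂ _<_ (sym eq₁) (sym eq₂) (ℕ.*-monoʳ-< d lt)

      residue-sum : ∑[ d ∣ q ] (μ (q / d) * + residue d) ≡
                    ∑[ r < w′ ] (+ residue (suc r) * divSum w q (suc r))
      residue-sum = begin
        ∑[ d ∣ q ] (μ (q / d) * + residue d)
          ≡⟨ ∑∣-cong q (λ d _ → cong (μ (q / d) *_)
               (expand-by-residue w′ (λ D → + residue D) residue-periodic residue-0 d)) ⟩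
        ∑[ d ∣ q ] (μ (q / d) * ∑[ r < w′ ] when (d % w ℕ.≟ suc r % w) (+ residue (suc r)))
          ≡⟨ ∑∣-cong q (λ d _ → trans (*-distribˡ-∑ w′ (μ (q / d)) _) (∑-cong w′ (λ r _ →
               swap-weight (d % w ℕ.≟ suc r % w) (μ (q / d)) (+ residue (suc r))))) ⟩
        ∑[ d ∣ q ] ∑[ r < w′ ] (+ residue (suc r) * when (d % w ℕ.≟ suc r % w) (μ (q / d)))
          ≡⟨ ∑∣-∑-comm q w′ (λ d r → + residue (suc r) * when (d % w ℕ.≟ suc r % w) (μ (q / d))) ⟩
        ∑[ r < w′ ] ∑[ d ∣ q ] (+ residue (suc r) * when (d % w ℕ.≟ suc r % w) (μ (q / d)))
          ≡⟨ ∑-cong w′ (λ r _ → trans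
               (sym (*-distribˡ-∑∣ q (+ residue (suc r))
                 (λ d → when (d % w ℕ.≟ suc r % w) (μ (q / d)))))
               (cong (+ residue (suc r) *_) (sym (divSum≡∑∣ w q (suc r))))) ⟩
        ∑[ r < w′ ] (+ residue (suc r) * divSum w q (suc r)) ∎
        where
        swap-weight : ∀ {ℓ} {A : Set ℓ} (a? : Dec A) x y → x * when a? y ≡ y * when a? x
        swap-weight a? x y =
          trans (*-when a? x y) (trans (cong (when a?) (ℤ.*-comm x y)) (sym (*-when a? y x)))

      weighted-count : ∀ {c} {C : Pred ℕ c} (C? : Decidable C) →
        (∀ p → C p ⇔ (w ∸ v) ℕ.* q < w ℕ.* p) →
        + w * ∑[ k < q ] when (C? (suc k) ×-dec (gcd (suc k) q ℕ.≟ 1)) (+ 1)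
          ≡ + v * + φ q + ∑[ r < w′ ] (+ residue (suc r) * divSum w q (suc r))
      weighted-count C? C⇔ = begin
        + w * ∑[ k < q ] when (C? (suc k) ×-dec (gcd (suc k) q ℕ.≟ 1)) (+ 1)
          ≡⟨ cong (+ w *_) (count-coprime≡∑∣ C? C⇔) ⟩
        + w * ∑[ d ∣ q ] (μ d * count (q / d))
          ≡⟨ *-distribˡ-∑∣ q (+ w) (λ d → μ d * count (q / d)) ⟩
        ∑[ d ∣ q ] (+ w * (μ d * count (q / d)))
          ≡⟨ ∑∣-cong q (λ d _ → weight (μ d) (q / d)) ⟩
        ∑[ d ∣ q ] (+ v * (μ d * + (q / d)) + μ d * + residue (q / d))
          ≡⟨ ∑∣-distrib-+ q (λ d → + v * (μ d * + (q / d))) (λ d → μ d * + residue (q / d)) ⟩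
        ∑[ d ∣ q ] (+ v * (μ d * + (q / d))) + ∑[ d ∣ q ] (μ d * + residue (q / d))
          ≡⟨ cong₂ _+_
               (trans (sym (*-distribˡ-∑∣ q (+ v) (λ d → μ d * + (q / d))))
                      (cong (+ v *_) (sym (φ≡∑∣ q 1≤q))))
               (∑∣-cofactor-swap q (λ d e → μ d * + residue e)) ⟩
        + v * + φ q + ∑[ d ∣ q ] (μ (q / d) * + residue d)
          ≡⟨ cong (_+_ (+ v * + φ q)) residue-sum ⟩
        + v * + φ q + ∑[ r < w′ ] (+ residue (suc r) * divSum w q (suc r)) ∎
        where
        weight : ∀ m D → + w * (m * count D) ≡ + v * (m * + D) + m * + residue D
        weight m D = begin
          + w * (m * count D)
            ≡⟨ ℤ-x*yz≡y*xz (+ w) m (count D) ⟩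
          m * (+ w * count D)
            ≡⟨ cong (m *_) (*-count-above v w D v≤w) ⟩
          m * (+ (v ℕ.* D) + + residue D)
            ≡⟨ ℤ.*-distribˡ-+ m (+ (v ℕ.* D)) (+ residue D) ⟩
          m * + (v ℕ.* D) + m * + residue D
            ≡⟨ cong (λ x → m * x + m * + residue D) (ℤ.pos-* v D) ⟩
          m * (+ v * + D) + m * + residue D
            ≡⟨ cong (_+ m * + residue D) (ℤ-x*yz≡y*xz m (+ v) (+ D)) ⟩
          + v * (m * + D) + m * + residue D ∎

module RationalArithmetic where

  open import Data.Rational as ℚ using (ℚ; 1ℚ; floor; toℚᵘ; _+_; _*_; _-_)
  import Data.Rational.Properties as ℚ
  open import Data.Rational.Unnormalised as ℚᵘ using (mkℚᵘ; *≡*; *<*)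
  import Data.Rational.Unnormalised.Properties as ℚᵘ
  open import Data.Integer.Solver using (module +-*-Solver)
  import Data.Rational.Solver as ℚ-Solver
  open IntegerSums using (∑)

  toℚᵘ-/ : ∀ z d → toℚᵘ (z ℚ./ suc d) ℚᵘ.≃ mkℚᵘ z d
  toℚᵘ-/ z d = ℚ.toℚᵘ-fromℚᵘ (mkℚᵘ z d)

  ℤ→ℚ-homo-+ : ∀ x y → ℤ→ℚ (x ℤ.+ y) ≡ ℤ→ℚ x + ℤ→ℚ y
  ℤ→ℚ-homo-+ x y = ℚ.toℚᵘ-injective (begin
    toℚᵘ (ℤ→ℚ (x ℤ.+ y))
      ≈⟨ toℚᵘ-/ (x ℤ.+ y) 0 ⟩
    mkℚᵘ (x ℤ.+ y) 0
      ≈⟨ *≡* (solve 2 (λ x y → (x :+ y) :* con (+ 1) := (x :* con (+ 1) :+ y :* con (+ 1)) :* con (+ 1))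
               refl x y) ⟩
    mkℚᵘ x 0 ℚᵘ.+ mkℚᵘ y 0
      ≈⟨ ℚᵘ.+-cong (ℚᵘ.≃-sym (toℚᵘ-/ x 0)) (ℚᵘ.≃-sym (toℚᵘ-/ y 0)) ⟩
    toℚᵘ (ℤ→ℚ x) ℚᵘ.+ toℚᵘ (ℤ→ℚ y)
      ≈⟨ ℚᵘ.≃-sym (ℚ.toℚᵘ-homo-+ (ℤ→ℚ x) (ℤ→ℚ y)) ⟩
    toℚᵘ (ℤ→ℚ x + ℤ→ℚ y) ∎)
    where
    open ℚᵘ.≃-Reasoning
    open +-*-Solver

  ℤ→ℚ-homo-* : ∀ x y → ℤ→ℚ (x ℤ.* y) ≡ ℤ→ℚ x * ℤ→ℚ y
  ℤ→ℚ-homo-* x y = ℚ.toℚᵘ-injective (begin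
    toℚᵘ (ℤ→ℚ (x ℤ.* y))              ≈⟨ toℚᵘ-/ (x ℤ.* y) 0 ⟩
    mkℚᵘ (x ℤ.* y) 0                  ≈⟨ ℚᵘ.≃-refl ⟩
    mkℚᵘ x 0 ℚᵘ.* mkℚᵘ y 0            ≈⟨ ℚᵘ.*-cong (ℚᵘ.≃-sym (toℚᵘ-/ x 0)) (ℚᵘ.≃-sym (toℚᵘ-/ y 0)) ⟩
    toℚᵘ (ℤ→ℚ x) ℚᵘ.* toℚᵘ (ℤ→ℚ y)    ≈⟨ ℚᵘ.≃-sym (ℚ.toℚᵘ-homo-* (ℤ→ℚ x) (ℤ→ℚ y)) ⟩
    toℚᵘ (ℤ→ℚ x * ℤ→ℚ y) ∎)
    where open ℚᵘ.≃-Reasoning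

  ℤ→ℚ-mono-< : ∀ {x y} → x ℤ.< y → ℤ→ℚ x ℚ.< ℤ→ℚ y
  ℤ→ℚ-mono-< {x} {y} x<y = ℚ.toℚᵘ-cancel-< (ℚᵘ.<-respʳ-≃ (ℚᵘ.≃-sym (toℚᵘ-/ y 0))
    (ℚᵘ.<-respˡ-≃ (ℚᵘ.≃-sym (toℚᵘ-/ x 0))
      (*<* (subst₂ ℤ._<_ (sym (ℤ.*-identityʳ x)) (sym (ℤ.*-identityʳ y)) x<y))))

  ℤ→ℚ-cancel-< : ∀ {x y} → ℤ→ℚ x ℚ.< ℤ→ℚ y → x ℤ.< y
  ℤ→ℚ-cancel-< {x} {y} lt with ℚᵘ.<-respʳ-≃ (toℚᵘ-/ y 0) (ℚᵘ.<-respˡ-≃ (toℚᵘ-/ x 0) (ℚ.toℚᵘ-mono-< lt))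
  ... | *<* x*1<y*1 = subst₂ ℤ._<_ (ℤ.*-identityʳ x) (ℤ.*-identityʳ y) x*1<y*1

  ℕ→ℚ-suc-positive : ∀ n → ℚ.Positive (ℕ→ℚ (suc n))
  ℕ→ℚ-suc-positive n = ℚ.positive (ℤ→ℚ-mono-< {+ 0} {+ suc n} (ℤ.+<+ ℕ.z<s))

  /-*-cancel : ∀ z w′ → (z ℚ./ suc w′) * ℤ→ℚ (+ suc w′) ≡ ℤ→ℚ z
  /-*-cancel z w′ = ℚ.toℚᵘ-injective (begin
    toℚᵘ ((z ℚ./ suc w′) * ℤ→ℚ (+ suc w′))
      ≈⟨ ℚ.toℚᵘ-homo-* (z ℚ./ suc w′) (ℤ→ℚ (+ suc w′)) ⟩
    toℚᵘ (z ℚ./ suc w′) ℚᵘ.* toℚᵘ (ℤ→ℚ (+ suc w′))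
      ≈⟨ ℚᵘ.*-cong (toℚᵘ-/ z w′) (toℚᵘ-/ (+ suc w′) 0) ⟩
    mkℚᵘ z w′ ℚᵘ.* mkℚᵘ (+ suc w′) 0
      ≈⟨ *≡* (solve 2 (λ z w → (z :* w) :* con (+ 1) := z :* (w :* con (+ 1))) refl z (+ suc w′)) ⟩
    mkℚᵘ z 0
      ≈⟨ ℚᵘ.≃-sym (toℚᵘ-/ z 0) ⟩
    toℚᵘ (ℤ→ℚ z) ∎)
    where
    open ℚᵘ.≃-Reasoning
    open +-*-Solver

  floor-/ : ∀ n w′ → floor (+ n ℚ./ suc w′) ≡ + (n ℕ./ suc w′)
  floor-/ n w′ = trans
    (floor-reduced (+ n ℚ./ w) (n ℕ./ g) (w ℕ./ g) ⦃ w/g≢0 ⦄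
      (ℚ.↥-mkℚ+ _ _ ⦃ w/g≢0 ⦄) (ℚ.↧-mkℚ+ _ _ ⦃ w/g≢0 ⦄))
    (cong +_ (cancel-common (n ℕ./ g) (w ℕ./ g) n w ⦃ w/g≢0 ⦄
      (m/n*n≡m (gcd[m,n]∣m n w)) (m/n*n≡m (gcd[m,n]∣n n w))))
    where
    w = suc w′
    g = gcd n w
    instance
      g≢0 : NonZero g
      g≢0 = ℕ.≢-nonZero (gcd[m,n]≢0 n w (inj₂ (λ ())))
    w/g≢0 : NonZero (w ℕ./ g)
    w/g≢0 = ℕ.≢-nonZero (λ w/g≡0 → ℕ.0≢1+n (trans (sym (ℕ.*-zeroˡ g))
              (trans (cong (ℕ._* g) (sym w/g≡0)) (m/n*n≡m (gcd[m,n]∣n n w)))))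
    floor-reduced : ∀ p a b .{{_ : NonZero b}} → ℚ.↥ p ≡ + a → ℚ.↧ p ≡ + b → floor p ≡ + (a ℕ./ b)
    floor-reduced (ℚ.mkℚ (+ a) d _) .a .(suc d) refl refl = ℤ.*-identityˡ _
    cancel-common : ∀ a b m k .{{_ : NonZero b}} .{{_ : NonZero k}} → a ℕ.* g ≡ m → b ℕ.* g ≡ k →
      a ℕ./ b ≡ m ℕ./ k
    cancel-common a b _ _ refl refl = sym (m*n/o*n≡m/o a g b)

  1-frac[n/w]*w : ∀ n w′ → (1ℚ - frac (+ n ℚ./ suc w′)) * ℕ→ℚ (suc w′) ≡ ℕ→ℚ (suc w′ ∸ n % suc w′)
  1-frac[n/w]*w n w′ = begin
    (1ℚ - (x - ℤ→ℚ (floor x))) * W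
      ≡⟨ cong (λ f → (1ℚ - (x - ℤ→ℚ f)) * W) (floor-/ n w′) ⟩
    (1ℚ - (x - F)) * W
      ≡⟨ solve 3 (λ x F W → (con 1ℚ :- (x :- F)) :* W := (W :+ F :* W) :- x :* W) refl x F W ⟩
    (W + F * W) - x * W
      ≡⟨ cong₂ (λ a b → (W + a) - b) (sym (ℤ→ℚ-homo-* (+ (n ℕ./ w)) (+ w))) (/-*-cancel (+ n) w′) ⟩
    (W + ℤ→ℚ (+ (n ℕ./ w) ℤ.* + w)) - N
      ≡⟨ cong (_- N) (sym (ℤ→ℚ-homo-+ (+ w) (+ (n ℕ./ w) ℤ.* + w))) ⟩
    ℤ→ℚ (+ w ℤ.+ + (n ℕ./ w) ℤ.* + w) - N
      ≡⟨ cong (λ z → ℤ→ℚ z - N) balance ⟩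
    ℤ→ℚ (+ (w ∸ n % w) ℤ.+ + n) - N
      ≡⟨ cong (_- N) (ℤ→ℚ-homo-+ (+ (w ∸ n % w)) (+ n)) ⟩
    (ℕ→ℚ (w ∸ n % w) + N) - N
      ≡⟨ solve 2 (λ a b → (a :+ b) :- b := a) refl (ℕ→ℚ (w ∸ n % w)) N ⟩
    ℕ→ℚ (w ∸ n % w) ∎
    where
    open ≡-Reasoning
    open ℚ-Solver.+-*-Solver
    w = suc w′
    x = + n ℚ./ w
    F = ℤ→ℚ (+ (n ℕ./ w))
    W = ℕ→ℚ w
    N = ℕ→ℚ n
    balance : + w ℤ.+ + (n ℕ./ w) ℤ.* + w ≡ + (w ∸ n % w) ℤ.+ + n
    balance = begin
      + w ℤ.+ + (n ℕ./ w) ℤ.* + w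
        ≡⟨ cong (ℤ._+_ (+ w)) (ℤ.pos-* (n ℕ./ w) w) ⟨
      + (w ℕ.+ n ℕ./ w ℕ.* w)
        ≡⟨ cong +_ (cong (ℕ._+ n ℕ./ w ℕ.* w) (ℕ.m∸n+n≡m (ℕ.<⇒≤ (m%n<n n w)))) ⟨
      + ((w ∸ n % w) ℕ.+ n % w ℕ.+ n ℕ./ w ℕ.* w)
        ≡⟨ cong +_ (ℕ.+-assoc (w ∸ n % w) (n % w) _) ⟩
      + ((w ∸ n % w) ℕ.+ (n % w ℕ.+ n ℕ./ w ℕ.* w))
        ≡⟨ cong (λ m → + ((w ∸ n % w) ℕ.+ m)) (m≡m%n+[m/n]*n n w) ⟨
      + ((w ∸ n % w) ℕ.+ n)
        ≡⟨ ℤ.pos-+ (w ∸ n % w) n ⟩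
      + (w ∸ n % w) ℤ.+ + n ∎

  α*r≡vr/w : ∀ v w′ r → α v (suc w′) * ℕ→ℚ r ≡ + (v ℕ.* r) ℚ./ suc w′
  α*r≡vr/w v w′ r = ℚ.toℚᵘ-injective (begin
    toℚᵘ (α v (suc w′) * ℕ→ℚ r)
      ≈⟨ ℚ.toℚᵘ-homo-* (α v (suc w′)) (ℕ→ℚ r) ⟩
    toℚᵘ (α v (suc w′)) ℚᵘ.* toℚᵘ (ℕ→ℚ r)
      ≈⟨ ℚᵘ.*-cong (toℚᵘ-/ (+ v) w′) (toℚᵘ-/ (+ r) 0) ⟩
    mkℚᵘ (+ v) w′ ℚᵘ.* mkℚᵘ (+ r) 0
      ≈⟨ *≡* (cong₂ ℤ._*_ (sym (ℤ.pos-* v r)) (cong (λ k → + suc k) (sym (ℕ.*-identityʳ w′)))) ⟩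
    mkℚᵘ (+ (v ℕ.* r)) w′
      ≈⟨ ℚᵘ.≃-sym (toℚᵘ-/ (+ (v ℕ.* r)) w′) ⟩
    toℚᵘ (+ (v ℕ.* r) ℚ./ suc w′) ∎)
    where open ℚᵘ.≃-Reasoning

  below-threshold⇔ : ∀ v w′ q p → v ≤ suc w′ →
    (1ℚ - α v (suc w′)) * ℕ→ℚ q ℚ.< ℕ→ℚ p ⇔ (suc w′ ∸ v) ℕ.* q ℕ.< suc w′ ℕ.* p
  below-threshold⇔ v w′ q p v≤w = mk⇔
    (λ lt → ℤ.drop‿+<+ (ℤ→ℚ-cancel-< (subst₂ ℚ._<_ lhs rhs (ℚ.*-monoˡ-<-pos W lt))))
    (λ lt → ℚ.*-cancelʳ-<-nonNeg W ⦃ ℚ.pos⇒nonNeg W ⦄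
      (subst₂ ℚ._<_ (sym lhs) (sym rhs) (ℤ→ℚ-mono-< (ℤ.+<+ lt))))
    where
    open ≡-Reasoning
    open ℚ-Solver.+-*-Solver
    w = suc w′
    W = ℕ→ℚ w
    V = ℕ→ℚ v
    Q = ℕ→ℚ q
    instance
      W-pos : ℚ.Positive W
      W-pos = ℕ→ℚ-suc-positive w′
    [w∸v]+v≡w : ℕ→ℚ (w ∸ v) + V ≡ W
    [w∸v]+v≡w = trans (sym (ℤ→ℚ-homo-+ (+ (w ∸ v)) (+ v))) (cong (λ n → ℕ→ℚ n) (ℕ.m∸n+n≡m v≤w))
    lhs : (1ℚ - α v w) * Q * W ≡ ℤ→ℚ (+ ((w ∸ v) ℕ.* q))
    lhs = begin
      (1ℚ - α v w) * Q * W
        ≡⟨ solve 3 (λ a Q W → (con 1ℚ :- a) :* Q :* W := (W :- a :* W) :* Q) refl (α v w) Q W ⟩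
      (W - α v w * W) * Q
        ≡⟨ cong (λ y → (W - y) * Q) (/-*-cancel (+ v) w′) ⟩
      (W - V) * Q
        ≡⟨ cong (λ y → (y - V) * Q) [w∸v]+v≡w ⟨
      (ℕ→ℚ (w ∸ v) + V - V) * Q
        ≡⟨ cong (_* Q) (solve 2 (λ a b → (a :+ b) :- b := a) refl (ℕ→ℚ (w ∸ v)) V) ⟩
      ℕ→ℚ (w ∸ v) * Q
        ≡⟨ ℤ→ℚ-homo-* (+ (w ∸ v)) (+ q) ⟨
      ℤ→ℚ (+ (w ∸ v) ℤ.* + q)
        ≡⟨ cong ℤ→ℚ (ℤ.pos-* (w ∸ v) q) ⟨
      ℤ→ℚ (+ ((w ∸ v) ℕ.* q)) ∎
    rhs : ℕ→ℚ p * W ≡ ℤ→ℚ (+ (w ℕ.* p))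
    rhs = trans (sym (ℤ→ℚ-homo-* (+ p) (+ w)))
      (cong ℤ→ℚ (trans (sym (ℤ.pos-* p w)) (cong +_ (ℕ.*-comm p w))))

  sumℚ-applyUpTo-* : ∀ n (F : ℕ → ℚ) (h : ℕ → ℤ) W → (∀ k → k ℕ.< n → F k * W ≡ ℤ→ℚ (h k)) →
    sumℚ (applyUpTo F n) * W ≡ ℤ→ℚ (∑ n h)
  sumℚ-applyUpTo-* zero    F h W eq = ℚ.*-zeroˡ W
  sumℚ-applyUpTo-* (suc n) F h W eq = begin
    (F 0 + sumℚ (applyUpTo (F ∘ suc) n)) * W
      ≡⟨ ℚ.*-distribʳ-+ W (F 0) _ ⟩
    F 0 * W + sumℚ (applyUpTo (F ∘ suc) n) * W
      ≡⟨ cong₂ _+_ (eq 0 ℕ.z<s) (sumℚ-applyUpTo-* n (F ∘ suc) (h ∘ suc) W (λ k → eq (suc k) ∘ s≤s)) ⟩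
    ℤ→ℚ (h 0) + ℤ→ℚ (∑ n (h ∘ suc))
      ≡⟨ ℤ→ℚ-homo-+ (h 0) _ ⟨
    ℤ→ℚ (∑ (suc n) h) ∎
    where open ≡-Reasoning

  sumℚ-range1-* : ∀ n (G : ℕ → ℚ) (h : ℕ → ℤ) W → (∀ r → 1 ≤ r → r ≤ n → G r * W ≡ ℤ→ℚ (h r)) →
    sumℚ (map G (range1 n)) * W ≡ ℤ→ℚ (∑[ k < n ] h (suc k))
  sumℚ-range1-* n G h W eq = begin
    sumℚ (map G (map suc (applyUpTo id n))) * W
      ≡⟨ cong (λ xs → sumℚ (map G xs) * W) (map-applyUpTo id suc n) ⟩
    sumℚ (map G (applyUpTo suc n)) * W
      ≡⟨ cong (λ xs → sumℚ xs * W) (map-applyUpTo suc G n) ⟩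
    sumℚ (applyUpTo (G ∘ suc) n) * W
      ≡⟨ sumℚ-applyUpTo-* n (G ∘ suc) (h ∘ suc) W (λ k k<n → eq (suc k) (s≤s z≤n) k<n) ⟩
    ℤ→ℚ (∑[ k < n ] h (suc k)) ∎
    where open ≡-Reasoning

  *-cancelʳ-≡-pos : ∀ {x y} W .{{_ : ℚ.Positive W}} → x * W ≡ y * W → x ≡ y
  *-cancelʳ-≡-pos W xW≡yW = ℚ.≤-antisym
    (ℚ.*-cancelʳ-≤-pos W (ℚ.≤-reflexive xW≡yW)) (ℚ.*-cancelʳ-≤-pos W (ℚ.≤-reflexive (sym xW≡yW)))

open IntegerSums
open RationalArithmetic

open import Data.Rational as ℚ using (ℚ; 1ℚ; _+_; _*_; _-_)
import Data.Rational.Properties as ℚ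
import Data.Rational.Solver as ℚ-Solver

δ-weighted : ∀ v w′ → v ≤ suc w′ → ∀ q → 1 ≤ q →
  + suc w′ ℤ.* + δ v (suc w′) q ≡
  + v ℤ.* + φ q ℤ.+ ∑[ r < w′ ] (+ residue v w′ (suc r) ℤ.* divSum (suc w′) q (suc r))
δ-weighted v w′ v≤w q 1≤q = trans
  (cong (+ suc w′ ℤ.*_) (length-filter-range1 (λ p → below? p ×-dec (gcd p q ℕ.≟ 1)) q))
  (weighted-count v w′ v≤w q 1≤q below? (λ p → below-threshold⇔ v w′ q p v≤w))
  where
  below? : ∀ p → Dec ((1ℚ - α v (suc w′)) * ℕ→ℚ q ℚ.< ℕ→ℚ p)
  below? p = (1ℚ - α v (suc w′)) * ℕ→ℚ q ℚ.<? ℕ→ℚ p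

residue-as-fraction : ∀ v w′ r → v ≤ suc w′ → Coprime v (suc w′) → 1 ≤ r → r ≤ w′ →
  ℕ→ℚ (residue v w′ r) ≡ (1ℚ - frac (α v (suc w′) * ℕ→ℚ r)) * ℕ→ℚ (suc w′)
residue-as-fraction v w′ r v≤w cop 1≤r r≤w′ = begin
  ℕ→ℚ ((w ∸ v) ℕ.* r % w)
    ≡⟨ cong ℕ→ℚ ([w∸v]*r%w v w r v≤w vr%w≢0) ⟩
  ℕ→ℚ (w ∸ v ℕ.* r % w)
    ≡⟨ 1-frac[n/w]*w (v ℕ.* r) w′ ⟨
  (1ℚ - frac (+ (v ℕ.* r) ℚ./ w)) * ℕ→ℚ w
    ≡⟨ cong (λ x → (1ℚ - frac x) * ℕ→ℚ w) (α*r≡vr/w v w′ r) ⟨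
  (1ℚ - frac (α v w * ℕ→ℚ r)) * ℕ→ℚ w ∎
  where
  open ≡-Reasoning
  w = suc w′
  vr%w≢0 : v ℕ.* r % w ≢ 0
  vr%w≢0 vr%w≡0 = >⇒∤ ⦃ ℕ.>-nonZero 1≤r ⦄ (s≤s r≤w′)
    (coprime-divisor (Coprime.sym cop) (m%n≡0⇒n∣m (v ℕ.* r) w vr%w≡0))

κ-weighted : ∀ v w′ → v ≤ suc w′ → Coprime v (suc w′) → ∀ q →
  κ v (suc w′) q * ℕ→ℚ (suc w′) ≡
  ℤ→ℚ (∑[ r < w′ ] (+ residue v w′ (suc r) ℤ.* divSum (suc w′) q (suc r)))
κ-weighted v w′ v≤w cop q = sumℚ-range1-* w′ _ (λ r → + residue v w′ r ℤ.* divSum w q r) (ℕ→ℚ w) term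
  where
  open ≡-Reasoning
  open ℚ-Solver.+-*-Solver
  w = suc w′
  term : ∀ r → 1 ≤ r → r ≤ w′ →
    (1ℚ - frac (α v w * ℕ→ℚ r)) * ℤ→ℚ (divSum w q r) * ℕ→ℚ w ≡ ℤ→ℚ (+ residue v w′ r ℤ.* divSum w q r)
  term r 1≤r r≤w′ = begin
    (1ℚ - frac (α v w * ℕ→ℚ r)) * ℤ→ℚ (divSum w q r) * ℕ→ℚ w
      ≡⟨ solve 3 (λ x y z → x :* y :* z := x :* z :* y) refl
           (1ℚ - frac (α v w * ℕ→ℚ r)) (ℤ→ℚ (divSum w q r)) (ℕ→ℚ w) ⟩
    (1ℚ - frac (α v w * ℕ→ℚ r)) * ℕ→ℚ w * ℤ→ℚ (divSum w q r)
      ≡⟨ cong (_* ℤ→ℚ (divSum w q r)) (residue-as-fraction v w′ r v≤w cop 1≤r r≤w′) ⟨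
    ℕ→ℚ (residue v w′ r) * ℤ→ℚ (divSum w q r)
      ≡⟨ ℤ→ℚ-homo-* (+ residue v w′ r) (divSum w q r) ⟨
    ℤ→ℚ (+ residue v w′ r ℤ.* divSum w q r) ∎

lemma2p3 : (v w : ℕ) → .{{_ : NonZero w}} → 0 < v → v ≤ w → Coprime v w →
    (q : ℕ) → 1 ≤ q →
    ℕ→ℚ (δ v w q) ≡ α v w * ℕ→ℚ (φ q) + κ v w q
lemma2p3 v (suc w′) _ v≤w cop q 1≤q = *-cancelʳ-≡-pos W ⦃ ℕ→ℚ-suc-positive w′ ⦄ (begin
  ℕ→ℚ (δ v w q) * W
    ≡⟨ ℤ→ℚ-homo-* (+ δ v w q) (+ w) ⟨
  ℤ→ℚ (+ δ v w q ℤ.* + w)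
    ≡⟨ cong ℤ→ℚ (trans (ℤ.*-comm (+ δ v w q) (+ w)) (δ-weighted v w′ v≤w q 1≤q)) ⟩
  ℤ→ℚ (+ v ℤ.* + φ q ℤ.+ K)
    ≡⟨ ℤ→ℚ-homo-+ (+ v ℤ.* + φ q) K ⟩
  ℤ→ℚ (+ v ℤ.* + φ q) + ℤ→ℚ K
    ≡⟨ cong₂ _+_ (ℤ→ℚ-homo-* (+ v) (+ φ q)) (sym (κ-weighted v w′ v≤w cop q)) ⟩
  ℕ→ℚ v * ℕ→ℚ (φ q) + κ v w q * W
    ≡⟨ cong (λ x → x * ℕ→ℚ (φ q) + κ v w q * W) (/-*-cancel (+ v) w′) ⟨
  α v w * W * ℕ→ℚ (φ q) + κ v w q * W
    ≡⟨ solve 4 (λ a W F k → a :* W :* F :+ k :* W := (a :* F :+ k) :* W) refl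
         (α v w) W (ℕ→ℚ (φ q)) (κ v w q) ⟩
  (α v w * ℕ→ℚ (φ q) + κ v w q) * W ∎)
  where
  open ≡-Reasoning
  open ℚ-Solver.+-*-Solver
  w = suc w′
  W = ℕ→ℚ w
  K = ∑[ r < w′ ] (+ residue v w′ (suc r) ℤ.* divSum w q (suc r))
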